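{- Let $D$ be a finite simply-laced tree containing $\mathbf{E}_6$ as a subgraph (i.e. having a vertex of degree at least $3$ at which at least two of the components of the complement of that vertex have at least two vertices). Then (1) all non-fixed labelings of $D$ with exactly one component are equivalent to each other, and (2) all non-fixed labelings of $D$ with exactly two components are equivalent to each other.
   Context: Reeder's puzzle on a finite connected simple graph: a labeling assigns $a_j\in\mathbb{Z}/2\mathbb{Z}$ to each vertex $j$; the move $T_i$ replaces $a_i$ by $a_i+\sum_k a_k \pmod 2$ (sum over neighbors $k$ of $i$), other labels unchanged. Equivalence is generated by moves; a labeling is fixed if fixed by all moves. Components of a labeling are connected components of the subgraph induced on vertices labeled $1$. -}

module Defs where

open import Data.Nat using (ℕ; zero; suc)
open import Data.Fin using (Fin; zero; suc; inject₁; fromℕ; _≟_)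
open import Data.Bool using (Bool; true; false; _xor_; _∧_; if_then_else_)
open import Data.Vec using (Vec; lookup; tabulate)
open import Data.Vec.Functional using () renaming (foldr to foldrF)
open import Data.Product using (Σ; ∃; _×_; _,_)
open import Data.Sum using (_⊎_)
open import Data.Empty using (⊥)
open import Relation.Nullary using (¬_; does)
open import Relation.Binary.PropositionalEquality using (_≡_; _≢_)
open import Relation.Binary.Construct.Closure.ReflexiveTransitive using (Star)
open import Relation.Binary.Construct.Closure.Equivalence using (EqClosure)
open import Function.Definitions using (Injective)

record SimpleGraph (n : ℕ) : Set where
  field
    adj   : Fin n → Fin n → Bool
    sym   : ∀ i j → adj i j ≡ adj j i
    loopless : ∀ i → adj i i ≡ false

open SimpleGraph public

Adj : ∀ {n} → SimpleGraph n → Fin n → Fin n → Set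
Adj G i j = adj G i j ≡ true

Connected : ∀ {n} → SimpleGraph n → Set
Connected G = ∀ x y → Star (Adj G) x y

-- A cycle of length k+3 (≥ 3): distinct vertices c₀,…,c_{k+2} with
-- consecutive ones adjacent and the last adjacent to the first.
record Cycle {n : ℕ} (G : SimpleGraph n) : Set where
  field
    k      : ℕ
    vert   : Fin (suc (suc (suc k))) → Fin n
    inj    : Injective _≡_ _≡_ vert
    step   : ∀ (i : Fin (suc (suc k))) → Adj G (vert (inject₁ i)) (vert (suc i))
    close  : Adj G (vert (fromℕ (suc (suc k)))) (vert zero)

Acyclic : ∀ {n} → SimpleGraph n → Set
Acyclic G = Cycle G → ⊥

IsTree : ∀ {n} → SimpleGraph n → Set
IsTree G = Connected G × Acyclic G

ContainsE6 : ∀ {n} → SimpleGraph n → Set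
ContainsE6 {n} G = Σ (Fin n) λ v → Σ (Fin n) λ u₁ → Σ (Fin n) λ u₂ →
  Σ (Fin n) λ u₃ → Σ (Fin n) λ w₁ → Σ (Fin n) λ w₂ →
    (Adj G v u₁ × Adj G v u₂ × Adj G v u₃ × Adj G u₁ w₁ × Adj G u₂ w₂) ×
    (v ≢ u₁ × v ≢ u₂ × v ≢ u₃ × v ≢ w₁ × v ≢ w₂ ×
     u₁ ≢ u₂ × u₁ ≢ u₃ × u₁ ≢ w₁ × u₁ ≢ w₂ ×
     u₂ ≢ u₃ × u₂ ≢ w₁ × u₂ ≢ w₂ ×
     u₃ ≢ w₁ × u₃ ≢ w₂ ×
     w₁ ≢ w₂)

-- Labelings with values in ℤ/2ℤ ≅ Bool (true = 1, xor = addition).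
Labeling : ℕ → Set
Labeling n = Vec Bool n

nbrSum : ∀ {n} → SimpleGraph n → Labeling n → Fin n → Bool
nbrSum G a i = foldrF _xor_ false (λ k → adj G i k ∧ lookup a k)

move : ∀ {n} → SimpleGraph n → Fin n → Labeling n → Labeling n
move G i a = tabulate λ j →
  if does (j ≟ i) then lookup a i xor nbrSum G a i else lookup a j

Step : ∀ {n} → SimpleGraph n → Labeling n → Labeling n → Set
Step G a b = ∃ λ i → b ≡ move G i a

Equivalent : ∀ {n} → SimpleGraph n → Labeling n → Labeling n → Set
Equivalent G = EqClosure (Step G)

Fixed : ∀ {n} → SimpleGraph n → Labeling n → Set
Fixed G a = ∀ i → move G i a ≡ a

AdjOnes : ∀ {n} → SimpleGraph n → Labeling n → Fin n → Fin n → Set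
AdjOnes G a x y = lookup a x ≡ true × lookup a y ≡ true × Adj G x y

SameComponent : ∀ {n} → SimpleGraph n → Labeling n → Fin n → Fin n → Set
SameComponent G a = Star (AdjOnes G a)

OneComponent : ∀ {n} → SimpleGraph n → Labeling n → Set
OneComponent {n} G a = Σ (Fin n) λ r → lookup a r ≡ true ×
  (∀ x → lookup a x ≡ true → SameComponent G a r x)

TwoComponents : ∀ {n} → SimpleGraph n → Labeling n → Set
TwoComponents {n} G a = Σ (Fin n) λ r₁ → Σ (Fin n) λ r₂ →
  lookup a r₁ ≡ true × lookup a r₂ ≡ true ×
  ¬ SameComponent G a r₁ r₂ ×
  (∀ x → lookup a x ≡ true → SameComponent G a r₁ x ⊎ SameComponent G a r₂ x)

-- A move at v flips the label of v exactly when an odd number of neighbours of v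
-- are labelled 1.  In a tree, an unlabelled vertex x adjacent to a component of a
-- labelling has exactly one labelled neighbour there, since a second one would be
-- joined to the first avoiding x and close a cycle; so a labelling with one or two
-- components is grown, vertex by vertex, from one or two of its vertices.  A single
-- token walks along any edge, which settles one component.  Two tokens slide along a
-- path until they sit on two neighbours of a common centre; non-fixedness provides a
-- further edge at one of them, which lets this cherry rotate, travel to the branch
-- vertex v of E₆, and land on two neighbours of v.
module Submission where

open import Defs hiding (sym)
open import Data.Bool using (Bool; true; false; not; _xor_; _∧_; if_then_else_)
open import Data.Bool.Properties renaming (_≟_ to _≟ᵇ_)
  using (¬-not; xor-assoc; xor-same; xor-identityʳ; xor-comm)
open import Data.Empty using (⊥-elim)
open import Data.Fin using (Fin; zero; suc; _≟_; inject₁; fromℕ)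
open import Data.Fin.Properties using (0≢1+n; suc-injective; any?)
open import Data.List using (List; []; _∷_; allFin)
import Data.List.Membership.DecPropositional as ListMembership
open import Data.List.Membership.Propositional.Properties using (∈-allFin)
import Data.List.Relation.Binary.Subset.Propositional as ListSubset
open import Data.List.Relation.Unary.Any using (here; there)
open import Data.Nat using (ℕ)
open import Data.Product using (Σ-syntax; ∃-syntax; _×_; _,_; proj₁)
open import Data.Sum as Sum using (_⊎_; inj₁; inj₂; [_,_])
open import Data.Vec using (Vec; []; _∷_; lookup; tabulate)
open import Data.Vec.Functional using () renaming (foldr to foldrF)
import Data.Vec.Membership.DecPropositional as VecMembership
open import Data.Vec.Membership.Propositional.Properties using (∈-lookup)
open import Data.Vec.Properties using (lookup∘tabulate; tabulate-cong)
open import Data.Vec.Relation.Binary.Pointwise.Extensional using (ext; Pointwise-≡⇒≡)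
open import Data.Vec.Relation.Unary.All as All using (All; []; _∷_)
open import Data.Vec.Relation.Unary.All.Properties using (lookup⁻)
open import Data.Vec.Relation.Unary.AllPairs using ([]; _∷_)
import Data.Vec.Relation.Unary.Any as VecAny
open import Data.Vec.Relation.Unary.Unique.Propositional using (Unique)
open import Data.Vec.Relation.Unary.Unique.Propositional.Properties using (lookup-injective)
open import Function using (_∘_)
open import Function.Bundles using (_⇔_; mk⇔; module Equivalence)
open import Function.Properties.Equivalence using (⇔-isEquivalence)
open import Relation.Binary.Construct.Closure.Equivalence using (gfold; symmetric; setoid)
open import Relation.Binary.Construct.Closure.ReflexiveTransitive as Star using (Star; ε; _◅_; _◅◅_)
open import Relation.Binary.Construct.Closure.Symmetric using (fwd)
open import Relation.Binary.PropositionalEquality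
  using (_≡_; _≢_; refl; sym; trans; cong; cong₂; subst; ≢-sym; module ≡-Reasoning)
import Relation.Binary.Reasoning.Setoid as SetoidReasoning
open import Relation.Nullary using (¬_; ¬?; yes; no; does; Dec; _×-dec_)
open import Relation.Nullary.Decidable using (dec-true; dec-false; decidable-stable)

private variable m : ℕ

true≢false : true ≢ false
true≢false ()

∧-true : ∀ {p q} → p ∧ q ≡ true → p ≡ true × q ≡ true
∧-true {true} {true} refl = refl , refl

labeling-ext : ∀ {n} {a b : Labeling n} → (∀ j → lookup a j ≡ lookup b j) → a ≡ b
labeling-ext = Pointwise-≡⇒≡ ∘ ext

_⊆_ : ∀ {n} → Labeling n → Labeling n → Set
b ⊆ c = ∀ k → lookup b k ≡ true → lookup c k ≡ true

xorSum : ∀ {m} → (Fin m → Bool) → Bool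
xorSum = foldrF _xor_ false

xorSum-cong : ∀ {f g : Fin m → Bool} → (∀ k → f k ≡ g k) → xorSum f ≡ xorSum g
xorSum-cong {ℕ.zero} f≗g = refl
xorSum-cong {ℕ.suc m} f≗g = cong₂ _xor_ (f≗g zero) (xorSum-cong (f≗g ∘ suc))

xorSum-none : (f : Fin m → Bool) → (∀ k → f k ≡ false) → xorSum f ≡ false
xorSum-none {ℕ.zero} f none = refl
xorSum-none {ℕ.suc m} f none rewrite none zero = xorSum-none (f ∘ suc) (none ∘ suc)

xorSum-single : (f : Fin m → Bool) (t : Fin m) → f t ≡ true →
  (∀ k → f k ≡ true → k ≡ t) → xorSum f ≡ true
xorSum-single f zero ft only rewrite ft =
  cong not (xorSum-none (f ∘ suc) λ k → ¬-not λ e → 0≢1+n (sym (only (suc k) e)))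
xorSum-single f (suc t) ft only rewrite ¬-not {f zero} (0≢1+n ∘ only zero) =
  xorSum-single (f ∘ suc) t ft λ k e → suc-injective (only (suc k) e)

xorSum-pair : (f : Fin m → Bool) (t₁ t₂ : Fin m) → t₁ ≢ t₂ → f t₁ ≡ true → f t₂ ≡ true →
  (∀ k → f k ≡ true → k ≡ t₁ ⊎ k ≡ t₂) → xorSum f ≡ false
xorSum-pair f zero zero t₁≢t₂ _ _ _ = ⊥-elim (t₁≢t₂ refl)
xorSum-pair f zero (suc t₂) _ f₁ f₂ only rewrite f₁ =
  cong not (xorSum-single (f ∘ suc) t₂ f₂ λ k e → [ (λ ()) , suc-injective ] (only (suc k) e))
xorSum-pair f (suc t₁) zero _ f₁ f₂ only rewrite f₂ =
  cong not (xorSum-single (f ∘ suc) t₁ f₁ λ k e → [ suc-injective , (λ ()) ] (only (suc k) e))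
xorSum-pair f (suc t₁) (suc t₂) t₁≢t₂ f₁ f₂ only
  rewrite ¬-not {f zero} λ e → [ (λ ()) , (λ ()) ] (only zero e) =
  xorSum-pair (f ∘ suc) t₁ t₂ (t₁≢t₂ ∘ cong suc) f₁ f₂
    λ k e → Sum.map suc-injective suc-injective (only (suc k) e)

module Graph {n : ℕ} (G : SimpleGraph n) where
  open VecMembership (_≟_ {n}) using (_∈_; _∉_; _∈?_)

  private variable
    u v w x y z : Fin n
    ws : Vec (Fin n) m

  adj-sym : Adj G x y → Adj G y x
  adj-sym {x} {y} xy = trans (SimpleGraph.sym G y x) xy

  adj-irrefl : Adj G x y → x ≢ y
  adj-irrefl {x} xy refl = true≢false (trans (sym xy) (loopless G x))

  adj? : ∀ x y → Dec (Adj G x y)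
  adj? x y = adj G x y ≟ᵇ true

  other-neighbour? : ∀ x z → (∃[ w ] Adj G x w × w ≢ z) ⊎ (∀ w → Adj G x w → w ≡ z)
  other-neighbour? x z with any? (λ w → adj? x w ×-dec ¬? (w ≟ z))
  ... | yes (w , xw , w≢z) = inj₁ (w , xw , w≢z)
  ... | no none = inj₂ λ w xw → decidable-stable (w ≟ z) λ w≢z → none (w , xw , w≢z)

  data Path : Fin n → Fin n → Vec (Fin n) m → Set where
    [] : Path v v []
    _∷_ : Adj G u w → Path w v ws → Path u v (w ∷ ws)

  path-step : Path u v ws → ∀ i → Adj G (lookup (u ∷ ws) (inject₁ i)) (lookup (u ∷ ws) (suc i))
  path-step (uw ∷ p) zero = uw
  path-step (uw ∷ p) (suc i) = path-step p i

  path-end : Path u v ws → lookup (u ∷ ws) (fromℕ _) ≡ v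
  path-end [] = refl
  path-end (uw ∷ p) = path-end p

  AdjAvoiding : Fin n → Fin n → Fin n → Set
  AdjAvoiding x u w = Adj G u w × w ≢ x

  record AvoidingPath (x y z : Fin n) : Set where
    constructor mkPath
    field
      {length} : ℕ
      {vertices} : Vec (Fin n) length
      path : Path y z vertices
      unique : Unique (y ∷ vertices)
      avoids : All (_≢ x) (y ∷ vertices)

  private
    ∉⇒All≢ : y ∉ ws → All (y ≢_) ws
    ∉⇒All≢ {ws = ws} y∉ = lookup⁻ λ i e → y∉ (subst (_∈ ws) (sym e) (∈-lookup i ws))

    suffix : Path w z ws → y ∈ (w ∷ ws) → Unique (w ∷ ws) → All (_≢ x) (w ∷ ws) → AvoidingPath x y z
    suffix p (VecAny.here refl) u a = mkPath p u a
    suffix (_ ∷ p) (VecAny.there y∈) (_ ∷ u) (_ ∷ a) = suffix p y∈ u a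

  avoiding-path : y ≢ x → Star (AdjAvoiding x) y z → AvoidingPath x y z
  avoiding-path y≢x ε = mkPath [] ([] ∷ []) (y≢x ∷ [])
  avoiding-path {y = y} y≢x (_◅_ {j = w} (yw , w≢x) walk) with avoiding-path w≢x walk
  ... | mkPath {vertices = ws} p u a with y ∈? (w ∷ ws)
  ...   | yes y∈ = suffix p y∈ u a
  ...   | no y∉ = mkPath (yw ∷ p) (∉⇒All≢ y∉ ∷ u) (y≢x ∷ a)

  module _ (acyclic : Acyclic G) where

    neighbours-separated : Adj G x y → Adj G x z → y ≢ z → ¬ Star (AdjAvoiding x) y z
    neighbours-separated xy xz y≢z walk with avoiding-path (≢-sym (adj-irrefl xy)) walk
    ... | mkPath [] _ _ = y≢z refl
    neighbours-separated {x} {y} {z} xy xz y≢z walk | mkPath {ℕ.suc m} {w ∷ ws} p u a =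
      acyclic record
        { k = m
        ; vert = lookup (x ∷ y ∷ w ∷ ws)
        ; inj = λ {i} {j} → lookup-injective (All.map ≢-sym a ∷ u) i j
        ; step = λ { zero → xy ; (suc i) → path-step p i }
        ; close = subst (λ c → Adj G c x) (sym (path-end p)) (adj-sym xz)
        }

    no-triangle : Adj G x y → Adj G x z → ¬ Adj G y z
    no-triangle xy xz yz = neighbours-separated xy xz (adj-irrefl yz) ((yz , ≢-sym (adj-irrefl xz)) ◅ ε)

    no-square : Adj G x y → Adj G x z → y ≢ z → Adj G y w → w ≢ x → ¬ Adj G w z
    no-square xy xz y≢z yw w≢x wz =
      neighbours-separated xy xz y≢z ((yw , w≢x) ◅ (wz , ≢-sym (adj-irrefl xz)) ◅ ε)

module Indicator {n : ℕ} where
  open ListMembership (_≟_ {n}) using (_∈_; _∉_; _∈?_)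

  private variable
    j v x y : Fin n
    xs ys : List (Fin n)

  indicator : List (Fin n) → Labeling n
  indicator xs = tabulate λ j → does (j ∈? xs)

  -- pair x x is the labelling with x alone labelled 1.
  pair : Fin n → Fin n → Labeling n
  pair x y = indicator (x ∷ y ∷ [])

  indicator-∈ : j ∈ xs → lookup (indicator xs) j ≡ true
  indicator-∈ {j} {xs} j∈ = trans (lookup∘tabulate _ j) (dec-true (j ∈? xs) j∈)

  indicator-∉ : j ∉ xs → lookup (indicator xs) j ≡ false
  indicator-∉ {j} {xs} j∉ = trans (lookup∘tabulate _ j) (dec-false (j ∈? xs) j∉)

  indicator-true⇒∈ : lookup (indicator xs) j ≡ true → j ∈ xs
  indicator-true⇒∈ {xs} {j} e =
    decidable-stable (j ∈? xs) λ j∉ → true≢false (trans (sym e) (indicator-∉ j∉))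

  indicator-∷-other : j ≢ v → lookup (indicator (v ∷ xs)) j ≡ lookup (indicator xs) j
  indicator-∷-other {j} {v} {xs} j≢v with j ∈? xs
  ... | yes j∈ = trans (indicator-∈ (there j∈)) (sym (indicator-∈ j∈))
  ... | no j∉ = trans (indicator-∉ {xs = v ∷ xs} λ { (here j≡v) → j≢v j≡v ; (there j∈) → j∉ j∈ })
                      (sym (indicator-∉ j∉))

  indicator-cong : xs ListSubset.⊆ ys → ys ListSubset.⊆ xs → indicator xs ≡ indicator ys
  indicator-cong {xs} {ys} xs⊆ys ys⊆xs = tabulate-cong pointwise
    where
    pointwise : ∀ j → does (j ∈? xs) ≡ does (j ∈? ys)
    pointwise j with j ∈? xs
    ... | yes j∈ = sym (dec-true (j ∈? ys) (xs⊆ys j∈))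
    ... | no j∉ = sym (dec-false (j ∈? ys) (j∉ ∘ ys⊆xs))

  pair-comm : ∀ x y → pair x y ≡ pair y x
  pair-comm x y = indicator-cong swap swap
    where
    swap : ∀ {x y} → (x ∷ y ∷ []) ListSubset.⊆ (y ∷ x ∷ [])
    swap (here e) = there (here e)
    swap (there (here e)) = here e

module Moves {n : ℕ} (G : SimpleGraph n) where
  open Graph G
  open Indicator
  open ListMembership (_≟_ {n}) using (_∈_; _∉_)

  private variable
    a b : Labeling n
    i j t v : Fin n
    xs : List (Fin n)

  nbrSum-cong : (∀ k → Adj G v k → lookup a k ≡ lookup b k) → nbrSum G a v ≡ nbrSum G b v
  nbrSum-cong {v} {a} {b} same = xorSum-cong pointwise
    where
    pointwise : ∀ k → (adj G v k ∧ lookup a k) ≡ (adj G v k ∧ lookup b k)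
    pointwise k with adj G v k in vk
    ... | true = same k vk
    ... | false = refl

  nbrSum-none : (∀ k → Adj G v k → lookup a k ≡ false) → nbrSum G a v ≡ false
  nbrSum-none {v} {a} none = xorSum-none _ λ k → ¬-not λ e → let vk , ak = ∧-true {adj G v k} e in
    true≢false (trans (sym ak) (none k vk))

  nbrSum-single : Adj G v t → lookup a t ≡ true → (∀ k → Adj G v k → lookup a k ≡ true → k ≡ t) →
    nbrSum G a v ≡ true
  nbrSum-single {v} {t} vt at only = xorSum-single _ t (cong₂ _∧_ vt at) λ k e →
    let vk , ak = ∧-true {adj G v k} e in only k vk ak

  nbrSum-pair : ∀ {t₁ t₂} → t₁ ≢ t₂ →
    Adj G v t₁ → lookup a t₁ ≡ true → Adj G v t₂ → lookup a t₂ ≡ true →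
    (∀ k → Adj G v k → lookup a k ≡ true → k ≡ t₁ ⊎ k ≡ t₂) → nbrSum G a v ≡ false
  nbrSum-pair {v} {t₁ = t₁} {t₂} t₁≢t₂ vt₁ at₁ vt₂ at₂ only =
    xorSum-pair _ t₁ t₂ t₁≢t₂ (cong₂ _∧_ vt₁ at₁) (cong₂ _∧_ vt₂ at₂) λ k e →
      let vk , ak = ∧-true {adj G v k} e in only k vk ak

  lookup-move-self : ∀ a i → lookup (move G i a) i ≡ lookup a i xor nbrSum G a i
  lookup-move-self a i = trans (lookup∘tabulate _ i)
    (cong (λ c → if c then lookup a i xor nbrSum G a i else lookup a i) (dec-true (i ≟ i) refl))

  lookup-move-other : ∀ a i j → j ≢ i → lookup (move G i a) j ≡ lookup a j
  lookup-move-other a i j j≢i = trans (lookup∘tabulate _ j)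
    (cong (λ c → if c then lookup a i xor nbrSum G a i else lookup a j) (dec-false (j ≟ i) j≢i))

  nbrSum-move-self : ∀ a i → nbrSum G (move G i a) i ≡ nbrSum G a i
  nbrSum-move-self a i =
    nbrSum-cong {i} {move G i a} {a} λ k ik → lookup-move-other a i k (≢-sym (adj-irrefl ik))

  move-involutive : ∀ a i → move G i (move G i a) ≡ a
  move-involutive a i = labeling-ext pointwise
    where
    open ≡-Reasoning
    pointwise : ∀ j → lookup (move G i (move G i a)) j ≡ lookup a j
    pointwise j with j ≟ i
    ... | no j≢i = trans (lookup-move-other (move G i a) i j j≢i) (lookup-move-other a i j j≢i)
    ... | yes refl = begin
      lookup (move G j (move G j a)) j
        ≡⟨ lookup-move-self (move G j a) j ⟩
      lookup (move G j a) j xor nbrSum G (move G j a) j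
        ≡⟨ cong₂ _xor_ (lookup-move-self a j) (nbrSum-move-self a j) ⟩
      (lookup a j xor nbrSum G a j) xor nbrSum G a j
        ≡⟨ xor-assoc (lookup a j) _ _ ⟩
      lookup a j xor (nbrSum G a j xor nbrSum G a j)
        ≡⟨ cong (lookup a j xor_) (xor-same (nbrSum G a j)) ⟩
      lookup a j xor false
        ≡⟨ xor-identityʳ _ ⟩
      lookup a j ∎

  step-preserves-fixed : Step G a b → Fixed G a ⇔ Fixed G b
  step-preserves-fixed {a} (i , refl) = mk⇔
    (λ fixed → subst (Fixed G) (sym (fixed i)) fixed)
    (λ fixed → subst (Fixed G) (trans (sym (fixed i)) (move-involutive a i)) fixed)

  equivalent-preserves-fixed : Equivalent G a b → Fixed G a ⇔ Fixed G b
  equivalent-preserves-fixed = gfold ⇔-isEquivalence (Fixed G) step-preserves-fixed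

  vanishing-nbrSum-fixed : (∀ i → nbrSum G a i ≡ false) → Fixed G a
  vanishing-nbrSum-fixed {a} vanish i = labeling-ext pointwise
    where
    pointwise : ∀ j → lookup (move G i a) j ≡ lookup a j
    pointwise j with j ≟ i
    ... | no j≢i = lookup-move-other a i j j≢i
    ... | yes refl =
      trans (lookup-move-self a j) (trans (cong (lookup a j xor_) (vanish j)) (xor-identityʳ (lookup a j)))

  ≡⇒equivalent : a ≡ b → Equivalent G a b
  ≡⇒equivalent refl = ε

  labelled-after-move : lookup (move G i a) j ≡ true → j ≡ i ⊎ lookup a j ≡ true
  labelled-after-move {i} {a} {j} e with j ≟ i
  ... | yes j≡i = inj₁ j≡i
  ... | no j≢i = inj₂ (trans (sym (lookup-move-other a i j j≢i)) e)

  flip-equivalent : nbrSum G a v ≡ true → lookup b v ≡ not (lookup a v) →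
    (∀ j → j ≢ v → lookup b j ≡ lookup a j) → Equivalent G a b
  flip-equivalent {a} {v} {b} odd flipped unchanged = fwd (v , labeling-ext pointwise) ◅ ε
    where
    pointwise : ∀ j → lookup b j ≡ lookup (move G v a) j
    pointwise j with j ≟ v
    ... | no j≢v = trans (unchanged j j≢v) (sym (lookup-move-other a v j j≢v))
    ... | yes refl = sym (begin
      lookup (move G j a) j           ≡⟨ lookup-move-self a j ⟩
      lookup a j xor nbrSum G a j     ≡⟨ cong (lookup a j xor_) odd ⟩
      lookup a j xor true             ≡⟨ xor-comm (lookup a j) true ⟩
      not (lookup a j)                ≡⟨ sym flipped ⟩
      lookup b j                      ∎)
      where open ≡-Reasoning

  attach : v ∉ xs → Adj G v t → t ∈ xs → (∀ k → k ∈ xs → Adj G v k → k ≡ t) →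
    Equivalent G (indicator xs) (indicator (v ∷ xs))
  attach {xs = xs} v∉ vt t∈ only = flip-equivalent
    (nbrSum-single {a = indicator xs} vt (indicator-∈ t∈) λ k vk e → only k (indicator-true⇒∈ e) vk)
    (trans (indicator-∈ {xs = _ ∷ xs} (here refl)) (cong not (sym (indicator-∉ v∉))))
    (λ j → indicator-∷-other {xs = xs})

module Growth {n : ℕ} (G : SimpleGraph n) (acyclic : Acyclic G) where
  open Graph G
  open Moves G
  open Indicator
  open ListMembership (_≟_ {n}) using (_∈_)

  private variable
    b c : Labeling n
    k p q t x : Fin n
    S S′ : Fin n → Set

  component-mono : b ⊆ c → SameComponent G b p q → SameComponent G c p q
  component-mono b⊆c = Star.map λ { {u} {w} (bu , bw , uw) → b⊆c u bu , b⊆c w bw , uw }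

  component-sym : ∀ b → SameComponent G b p q → SameComponent G b q p
  component-sym b = Star.reverse λ { (bu , bw , uw) → bw , bu , adj-sym uw }

  -- roots-apart holds trivially when r₁ ≡ r₂ (one component), and vacuously when r₁ and r₂
  -- lie in different components of a (two components).
  module _ (a : Labeling n) (r₁ r₂ : Fin n) (roots-apart : SameComponent G a r₁ r₂ → r₁ ≡ r₂) where

    record Rooted (b : Labeling n) : Set where
      field
        below : b ⊆ a
        root₁ : lookup b r₁ ≡ true
        root₂ : lookup b r₂ ≡ true
        reached : ∀ t → lookup b t ≡ true → SameComponent G b r₁ t ⊎ SameComponent G b r₂ t

    rooted-connected : Rooted b → lookup b p ≡ true → lookup b q ≡ true →
      SameComponent G a p q → SameComponent G b p q
    rooted-connected {b} {p} {q} R bp bq pq with Rooted.reached R p bp | Rooted.reached R q bq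
    ... | inj₁ r₁p | inj₁ r₁q = component-sym b r₁p ◅◅ r₁q
    ... | inj₂ r₂p | inj₂ r₂q = component-sym b r₂p ◅◅ r₂q
    ... | inj₁ r₁p | inj₂ r₂q = component-sym b r₁p ◅◅ subst (λ r → SameComponent G b r q) (sym r₁≡r₂) r₂q
      where
      lift : ∀ {u w} → SameComponent G b u w → SameComponent G a u w
      lift = component-mono {b} {a} (Rooted.below R)
      r₁≡r₂ : r₁ ≡ r₂
      r₁≡r₂ = roots-apart (lift r₁p ◅◅ pq ◅◅ component-sym a (lift r₂q))
    ... | inj₂ r₂p | inj₁ r₁q = component-sym b r₂p ◅◅ subst (λ r → SameComponent G b r q) r₁≡r₂ r₁q
      where
      lift : ∀ {u w} → SameComponent G b u w → SameComponent G a u w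
      lift = component-mono {b} {a} (Rooted.below R)
      r₁≡r₂ : r₁ ≡ r₂
      r₁≡r₂ = roots-apart (lift r₁q ◅◅ component-sym a pq ◅◅ component-sym a (lift r₂p))

    -- A second labelled neighbour k of x is joined to t inside b, hence by a walk avoiding x.
    unique-labelled-neighbour : Rooted b → lookup b x ≡ false → lookup a x ≡ true →
      Adj G t x → lookup b t ≡ true → ∀ k → Adj G x k → lookup b k ≡ true → k ≡ t
    unique-labelled-neighbour {b} {x} {t} R bx ax tx bt k xk bk with k ≟ t
    ... | yes k≡t = k≡t
    ... | no k≢t = ⊥-elim (neighbours-separated acyclic (adj-sym tx) xk (≢-sym k≢t)
                             (avoiding-x (rooted-connected R bt bk through-x)))
      where
      through-x : SameComponent G a t k
      through-x = (Rooted.below R t bt , ax , tx) ◅ (ax , Rooted.below R k bk , xk) ◅ ε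
      avoiding-x : SameComponent G b t k → Star (AdjAvoiding x) t k
      avoiding-x = Star.map λ { (_ , bw , uw) → uw , λ { refl → true≢false (trans (sym bw) bx) } }

    record Extension (b : Labeling n) (S : Fin n → Set) : Set where
      field
        {grown} : Labeling n
        rooted : Rooted grown
        equivalent : Equivalent G b grown
        extends : b ⊆ grown
        covers : ∀ k → S k → lookup grown k ≡ true

    stay : Rooted b → Extension b (λ k → lookup b k ≡ true)
    stay R = record { rooted = R ; equivalent = ε ; extends = λ _ e → e ; covers = λ _ e → e }

    extension-mono : (∀ k → S′ k → S k) → Extension b S → Extension b S′
    extension-mono S′⊆S E = record { Extension E ; covers = λ k → Extension.covers E k ∘ S′⊆S k }

    _⨾_ : Extension b S → (∀ {c} → Rooted c → (∀ k → S k → lookup c k ≡ true) → Extension c S′) →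
      Extension b (λ k → S k ⊎ S′ k)
    E ⨾ continue = record
      { rooted = Extension.rooted E′
      ; equivalent = Extension.equivalent E ◅◅ Extension.equivalent E′
      ; extends = λ k → Extension.extends E′ k ∘ Extension.extends E k
      ; covers = λ k → [ Extension.extends E′ k ∘ Extension.covers E k , Extension.covers E′ k ]
      }
      where
      E′ : Extension (Extension.grown E) _
      E′ = continue (Extension.rooted E) (Extension.covers E)

    grow-step : Rooted b → lookup b x ≡ false → lookup a x ≡ true → Adj G t x → lookup b t ≡ true →
      Extension b (_≡ x)
    grow-step {b} {x} {t} R bx ax tx bt = record
      { rooted = record
        { below = λ k e → [ (λ { refl → ax }) , Rooted.below R k ] (labelled-after-move {a = b} e)
        ; root₁ = extends r₁ (Rooted.root₁ R)
        ; root₂ = extends r₂ (Rooted.root₂ R)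
        ; reached = λ k e → [ (λ { refl → Sum.map (λ p → lift p ◅◅ edge) (λ p → lift p ◅◅ edge)
                                                   (Rooted.reached R t bt) })
                            , Sum.map lift lift ∘ Rooted.reached R k ] (labelled-after-move {a = b} e)
        }
      ; equivalent = fwd (x , refl) ◅ ε
      ; extends = extends
      ; covers = λ { _ refl → cx }
      }
      where
      cx : lookup (move G x b) x ≡ true
      cx = begin
        lookup (move G x b) x      ≡⟨ lookup-move-self b x ⟩
        lookup b x xor nbrSum G b x ≡⟨ cong₂ _xor_ bx (nbrSum-single {a = b} (adj-sym tx) bt
                                         (unique-labelled-neighbour R bx ax tx bt)) ⟩
        true                        ∎
        where open ≡-Reasoning
      extends : b ⊆ move G x b
      extends k bk with k ≟ x
      ... | yes refl = cx
      ... | no k≢x = trans (lookup-move-other b x k k≢x) bk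
      lift : ∀ {u w} → SameComponent G b u w → SameComponent G (move G x b) u w
      lift = component-mono {b} {move G x b} extends
      edge : SameComponent G (move G x b) t x
      edge = (extends t bt , cx , tx) ◅ ε

    grow-along : Rooted b → lookup b p ≡ true → SameComponent G a p q → Extension b (_≡ q)
    grow-along R bp ε = extension-mono (λ { _ refl → bp }) (stay R)
    grow-along {b} R bp (_◅_ {j = p′} (_ , ap′ , pp′) walk) with lookup b p′ in bp′
    ... | true = grow-along R bp′ walk
    ... | false = extension-mono (λ _ → inj₂)
      (grow-step R bp′ ap′ pp′ bp ⨾ λ R′ covered → grow-along R′ (covered p′ refl) walk)

    module _ (cover : ∀ k → lookup a k ≡ true → SameComponent G a r₁ k ⊎ SameComponent G a r₂ k) where

      grow-vertex : ∀ k → Rooted b → Extension b (λ k′ → k′ ≡ k × lookup a k′ ≡ true)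
      grow-vertex {b} k R with lookup a k in ak
      ... | false = extension-mono (λ { _ (refl , e) → ⊥-elim (true≢false (trans (sym e) ak)) }) (stay R)
      ... | true = extension-mono (λ _ → proj₁)
        ([ grow-along R (Rooted.root₁ R) , grow-along R (Rooted.root₂ R) ] (cover k ak))

      grow-all : ∀ ks → Rooted b → Extension b (λ k → k ∈ ks × lookup a k ≡ true)
      grow-all [] R = extension-mono (λ { _ (() , _) }) (stay R)
      grow-all (k ∷ ks) R = extension-mono split (grow-vertex k R ⨾ λ R′ _ → grow-all ks R′)
        where
        split : ∀ k′ → k′ ∈ k ∷ ks × lookup a k′ ≡ true →
          (k′ ≡ k × lookup a k′ ≡ true) ⊎ (k′ ∈ ks × lookup a k′ ≡ true)
        split k′ (here k′≡k , ak′) = inj₁ (k′≡k , ak′)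
        split k′ (there k′∈ , ak′) = inj₂ (k′∈ , ak′)

      rooted-pair : lookup a r₁ ≡ true → lookup a r₂ ≡ true → Rooted (pair r₁ r₂)
      rooted-pair ar₁ ar₂ = record
        { below = λ k e → case (indicator-true⇒∈ e)
        ; root₁ = indicator-∈ {xs = r₁ ∷ r₂ ∷ []} (here refl)
        ; root₂ = indicator-∈ {xs = r₁ ∷ r₂ ∷ []} (there (here refl))
        ; reached = λ k e → reach (indicator-true⇒∈ e)
        }
        where
        case : k ∈ r₁ ∷ r₂ ∷ [] → lookup a k ≡ true
        case (here refl) = ar₁
        case (there (here refl)) = ar₂
        reach : k ∈ r₁ ∷ r₂ ∷ [] →
          SameComponent G (pair r₁ r₂) r₁ k ⊎ SameComponent G (pair r₁ r₂) r₂ k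
        reach (here refl) = inj₁ ε
        reach (there (here refl)) = inj₂ ε

      pair-equivalent : lookup a r₁ ≡ true → lookup a r₂ ≡ true → Equivalent G (pair r₁ r₂) a
      pair-equivalent ar₁ ar₂ = Extension.equivalent E ◅◅ ≡⇒equivalent (labeling-ext pointwise)
        where
        E : Extension (pair r₁ r₂) (λ k → k ∈ allFin n × lookup a k ≡ true)
        E = grow-all (allFin n) (rooted-pair ar₁ ar₂)
        pointwise : ∀ k → lookup (Extension.grown E) k ≡ lookup a k
        pointwise k with lookup a k in ak
        ... | true = Extension.covers E k (∈-allFin k , ak)
        ... | false = ¬-not λ e → true≢false (trans (sym (Rooted.below (Extension.rooted E) k e)) ak)

module Tokens {n : ℕ} (G : SimpleGraph n) (acyclic : Acyclic G) where
  open Graph G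
  open Moves G
  open Indicator
  open ListMembership (_≟_ {n}) using (_∈_; _∉_)
  open SetoidReasoning (setoid (Step G))

  private variable
    c v x x′ y y′ z : Fin n

  private
    ∉-pair : v ≢ x → v ≢ y → v ∉ x ∷ y ∷ []
    ∉-pair v≢x v≢y (here e) = v≢x e
    ∉-pair v≢x v≢y (there (here e)) = v≢y e

    sole-neighbour : ¬ Adj G v x → ∀ k → k ∈ x ∷ y ∷ [] → Adj G v k → k ≡ y
    sole-neighbour v≁x k (here refl) vk = ⊥-elim (v≁x vk)
    sole-neighbour v≁x k (there (here refl)) vk = refl

    doubled : ∀ k → k ∈ x ∷ x ∷ [] → Adj G v k → k ≡ x
    doubled k (here e) _ = e
    doubled k (there (here e)) _ = e

    swap-ends : ∀ {a b c : Fin n} → (a ∷ b ∷ c ∷ []) ListSubset.⊆ (c ∷ b ∷ a ∷ [])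
    swap-ends (here e) = there (there (here e))
    swap-ends (there (here e)) = there (here e)
    swap-ends (there (there (here e))) = here e

  singleton-step : Adj G x y → Equivalent G (pair x x) (pair y y)
  singleton-step {x} {y} xy = begin
    pair x x                   ≈⟨ attach (∉-pair y≢x y≢x) (adj-sym xy) (here refl) doubled ⟩
    indicator (y ∷ x ∷ x ∷ []) ≡⟨ indicator-cong exchange exchange ⟩
    indicator (x ∷ y ∷ y ∷ []) ≈⟨ attach (∉-pair x≢y x≢y) xy (here refl) doubled ⟨
    pair y y                   ∎
    where
    x≢y : x ≢ y
    x≢y = adj-irrefl xy
    y≢x : y ≢ x
    y≢x = ≢-sym x≢y
    exchange : ∀ {a b : Fin n} → (b ∷ a ∷ a ∷ []) ListSubset.⊆ (a ∷ b ∷ b ∷ [])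
    exchange (here e) = there (here e)
    exchange (there (here e)) = here e
    exchange (there (there (here e))) = here e

  slide : x ≢ y → ¬ Adj G x y → Adj G y y′ → y′ ≢ x → ¬ Adj G x y′ →
    Equivalent G (pair x y) (pair x y′)
  slide {x} {y} {y′} x≢y x≁y yy′ y′≢x x≁y′ = begin
    pair x y
      ≈⟨ attach (∉-pair y′≢x (≢-sym (adj-irrefl yy′))) (adj-sym yy′) (there (here refl))
                (sole-neighbour (x≁y′ ∘ adj-sym)) ⟩
    indicator (y′ ∷ x ∷ y ∷ [])
      ≡⟨ indicator-cong swap-ends swap-ends ⟩
    indicator (y ∷ x ∷ y′ ∷ [])
      ≈⟨ attach (∉-pair (≢-sym x≢y) (adj-irrefl yy′)) yy′ (there (here refl))
                (sole-neighbour (x≁y ∘ adj-sym)) ⟨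
    pair x y′ ∎

  slide-first : x ≢ y → ¬ Adj G x y → Adj G x x′ → x′ ≢ y → ¬ Adj G y x′ →
    Equivalent G (pair x y) (pair x′ y)
  slide-first {x} {y} {x′} x≢y x≁y xx′ x′≢y y≁x′ = begin
    pair x y  ≡⟨ pair-comm x y ⟩
    pair y x  ≈⟨ slide (≢-sym x≢y) (x≁y ∘ adj-sym) xx′ x′≢y y≁x′ ⟩
    pair y x′ ≡⟨ pair-comm y x′ ⟩
    pair x′ y ∎

  rotate : Adj G z x → Adj G z y → x ≢ y → Adj G x x′ → x′ ≢ z → Equivalent G (pair x y) (pair z x′)
  rotate {z} {x} {y} {x′} zx zy x≢y xx′ x′≢z = begin
    pair x y  ≈⟨ slide-first x≢y x≁y xx′ x′≢y y≁x′ ⟩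
    pair x′ y ≈⟨ slide x′≢y (y≁x′ ∘ adj-sym) (adj-sym zy) (≢-sym x′≢z) x′≁z ⟩
    pair x′ z ≡⟨ pair-comm x′ z ⟩
    pair z x′ ∎
    where
    x≁y : ¬ Adj G x y
    x≁y = no-triangle acyclic zx zy
    x′≢y : x′ ≢ y
    x′≢y refl = x≁y xx′
    y≁x′ : ¬ Adj G y x′
    y≁x′ = no-square acyclic zx zy x≢y xx′ x′≢z ∘ adj-sym
    x′≁z : ¬ Adj G x′ z
    x′≁z = no-triangle acyclic xx′ (adj-sym zx)

  -- Tokens on two neighbours of the centre z, and an edge leaving tip₁ away from z:
  -- the configuration in which two tokens can be rotated about and moved.
  record Cherry (z : Fin n) : Set where
    field
      {tip₁ tip₂ outer} : Fin n
      centre-tip₁ : Adj G z tip₁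
      centre-tip₂ : Adj G z tip₂
      tips-distinct : tip₁ ≢ tip₂
      tip₁-outer : Adj G tip₁ outer
      outer≢centre : outer ≢ z

    tokens : Labeling n
    tokens = pair tip₁ tip₂

  retarget : (ch : Cherry z) → Adj G z c → c ≢ Cherry.tip₁ ch →
    Equivalent G (Cherry.tokens ch) (pair (Cherry.tip₁ ch) c)
  retarget {z} {c} ch zc c≢tip₁ = begin
    pair tip₁ tip₂ ≈⟨ rotate centre-tip₁ centre-tip₂ tips-distinct tip₁-outer outer≢centre ⟩
    pair z outer   ≈⟨ rotate (adj-sym centre-tip₁) tip₁-outer (≢-sym outer≢centre) zc c≢tip₁ ⟩
    pair tip₁ c    ∎
    where open Cherry ch

  approach : Star (Adj G) x y → x ≢ y → ¬ Adj G x y →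
    ∃[ z ] ∃[ x′ ] ∃[ y′ ] Adj G z x′ × Adj G z y′ × x′ ≢ y′ × Equivalent G (pair x y) (pair x′ y′)
  approach ε x≢y _ = ⊥-elim (x≢y refl)
  approach {x} {y} (_◅_ {j = p} xp walk) x≢y x≁y with p ≟ y | adj? p y
  ... | yes refl | _ = ⊥-elim (x≁y xp)
  ... | no p≢y | yes py = p , x , y , adj-sym xp , py , x≢y , ε
  ... | no p≢y | no p≁y with approach walk p≢y p≁y
  ...   | z , x′ , y′ , zx′ , zy′ , x′≢y′ , p∼x′y′ =
    z , x′ , y′ , zx′ , zy′ , x′≢y′ , slide-first x≢y x≁y xp p≢y (p≁y ∘ adj-sym) ◅◅ p∼x′y′

  nonfixed-cherry : Adj G z x → Adj G z y → x ≢ y → ¬ Fixed G (pair x y) →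
    Σ[ ch ∈ Cherry z ] pair x y ≡ Cherry.tokens ch
  nonfixed-cherry {z} {x} {y} zx zy x≢y nonfixed with other-neighbour? x z | other-neighbour? y z
  ... | inj₁ (x′ , xx′ , x′≢z) | _ = record
    { centre-tip₁ = zx ; centre-tip₂ = zy ; tips-distinct = x≢y
    ; tip₁-outer = xx′ ; outer≢centre = x′≢z }
    , refl
  ... | inj₂ _ | inj₁ (y′ , yy′ , y′≢z) = record
    { centre-tip₁ = zy ; centre-tip₂ = zx ; tips-distinct = ≢-sym x≢y
    ; tip₁-outer = yy′ ; outer≢centre = y′≢z }
    , pair-comm x y
  ... | inj₂ x-leaf | inj₂ y-leaf = ⊥-elim (nonfixed (vanishing-nbrSum-fixed vanish))
    where
    tokens : ∀ {k} → k ∈ x ∷ y ∷ [] → k ≡ x ⊎ k ≡ y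
    tokens (here e) = inj₁ e
    tokens (there (here e)) = inj₂ e
    vanish : ∀ i → nbrSum G (pair x y) i ≡ false
    vanish i with i ≟ z
    ... | yes refl = nbrSum-pair {a = pair x y} x≢y zx (indicator-∈ {xs = x ∷ y ∷ []} (here refl))
                                     zy (indicator-∈ {xs = x ∷ y ∷ []} (there (here refl)))
                                     λ k _ e → tokens (indicator-true⇒∈ e)
    ... | no i≢z = nbrSum-none {a = pair x y} λ k ik → indicator-∉ {xs = x ∷ y ∷ []} λ
      { (here refl) → i≢z (x-leaf i (adj-sym ik))
      ; (there (here refl)) → i≢z (y-leaf i (adj-sym ik))
      }

  module _ {v u₁ u₂ : Fin n} (vu₁ : Adj G v u₁) (vu₂ : Adj G v u₂) (u₁≢u₂ : u₁ ≢ u₂) where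

    transport : (ch : Cherry z) → Star (Adj G) z v →
      Σ[ ch′ ∈ Cherry v ] Equivalent G (Cherry.tokens ch) (Cherry.tokens ch′)
    transport ch ε = ch , ε
    transport {z} ch (_◅_ {j = c} zc walk) with c ≟ Cherry.tip₁ ch | other-neighbour? c z
    ... | yes refl | _ =
      let ch′ , moved = transport at-tip₁ walk in ch′ ,
        rotate centre-tip₁ centre-tip₂ tips-distinct tip₁-outer outer≢centre ◅◅ moved
      where
      open Cherry ch
      at-tip₁ : Cherry c
      at-tip₁ = record
        { centre-tip₁ = adj-sym centre-tip₁ ; centre-tip₂ = tip₁-outer ; tips-distinct = ≢-sym outer≢centre
        ; tip₁-outer = centre-tip₂ ; outer≢centre = ≢-sym tips-distinct }
    ... | no c≢tip₁ | inj₁ (c′ , cc′ , c′≢z) =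
      let ch′ , moved = transport at-c walk in ch′ , (begin
        pair tip₁ tip₂ ≈⟨ retarget ch zc c≢tip₁ ⟩
        pair tip₁ c    ≡⟨ pair-comm tip₁ c ⟩
        pair c tip₁    ≈⟨ rotate zc centre-tip₁ c≢tip₁ cc′ c′≢z ⟩
        pair z c′      ≈⟨ moved ⟩
        Cherry.tokens ch′ ∎)
      where
      open Cherry ch
      at-c : Cherry c
      at-c = record
        { centre-tip₁ = adj-sym zc ; centre-tip₂ = cc′ ; tips-distinct = ≢-sym c′≢z
        ; tip₁-outer = centre-tip₁ ; outer≢centre = ≢-sym c≢tip₁ }
    -- At a leaf c the walk must turn back to z, or end there; but v is not a leaf.
    ... | no _ | inj₂ c-leaf with walk
    ...   | ε = ⊥-elim (u₁≢u₂ (trans (c-leaf u₁ vu₁) (sym (c-leaf u₂ vu₂))))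
    ...   | _◅_ {j = d} cd walk′ with c-leaf d cd
    ...     | refl = transport ch walk′

    module _ {w₁ : Fin n} (u₁w₁ : Adj G u₁ w₁) (w₁≢v : w₁ ≢ v) where

      gather : (ch : Cherry v) → Equivalent G (Cherry.tokens ch) (pair u₁ u₂)
      gather ch with Cherry.tip₁ ch ≟ u₁
      ... | yes refl = retarget ch vu₂ (≢-sym u₁≢u₂)
      ... | no tip₁≢u₁ = begin
        pair tip₁ tip₂ ≈⟨ retarget ch vu₁ (≢-sym tip₁≢u₁) ⟩
        pair tip₁ u₁   ≡⟨ pair-comm tip₁ u₁ ⟩
        pair u₁ tip₁   ≈⟨ retarget at-u₁ vu₂ (≢-sym u₁≢u₂) ⟩
        pair u₁ u₂     ∎
        where
        open Cherry ch
        at-u₁ : Cherry v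
        at-u₁ = record
          { centre-tip₁ = vu₁ ; centre-tip₂ = centre-tip₁ ; tips-distinct = ≢-sym tip₁≢u₁
          ; tip₁-outer = u₁w₁ ; outer≢centre = w₁≢v }

module NormalForms {n : ℕ} (D : SimpleGraph n) (connected : Connected D) (acyclic : Acyclic D) where
  open Graph D
  open Moves D
  open Indicator
  open Growth D acyclic
  open Tokens D acyclic

  singletons-equivalent : ∀ x y → Equivalent D (pair x x) (pair y y)
  singletons-equivalent x y = Star.concat (Star.gmap (λ x → pair x x) singleton-step (connected x y))

  one-component-normal-form : ∀ r₀ a → OneComponent D a → Equivalent D (pair r₀ r₀) a
  one-component-normal-form r₀ a (r , ar , reach) =
    singletons-equivalent r₀ r ◅◅ pair-equivalent a r r (λ _ → refl) (λ k → inj₁ ∘ reach k) ar ar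

  module _ {v u₁ u₂ w₁ : Fin n} (vu₁ : Adj D v u₁) (vu₂ : Adj D v u₂) (u₁≢u₂ : u₁ ≢ u₂)
           (u₁w₁ : Adj D u₁ w₁) (w₁≢v : w₁ ≢ v) where

    pair-normal-form : ∀ {x y} → x ≢ y → ¬ Adj D x y → ¬ Fixed D (pair x y) →
      Equivalent D (pair x y) (pair u₁ u₂)
    pair-normal-form {x} {y} x≢y x≁y nonfixed with approach (connected x y) x≢y x≁y
    ... | z , x′ , y′ , zx′ , zy′ , x′≢y′ , xy∼x′y′
      with nonfixed-cherry zx′ zy′ x′≢y′ (nonfixed ∘ Equivalence.from (equivalent-preserves-fixed xy∼x′y′))
    ...   | ch , x′y′≡ch with transport vu₁ vu₂ u₁≢u₂ ch (connected z v)
    ...     | ch′ , moved =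
      xy∼x′y′ ◅◅ ≡⇒equivalent x′y′≡ch ◅◅ moved ◅◅ gather vu₁ vu₂ u₁≢u₂ u₁w₁ w₁≢v ch′

    two-components-normal-form : ∀ a → ¬ Fixed D a → TwoComponents D a → Equivalent D a (pair u₁ u₂)
    two-components-normal-form a nonfixed (r₁ , r₂ , ar₁ , ar₂ , apart , cover) =
      symmetric (Step D) grown ◅◅
      pair-normal-form r₁≢r₂ r₁≁r₂ (nonfixed ∘ Equivalence.to (equivalent-preserves-fixed grown))
      where
      grown : Equivalent D (pair r₁ r₂) a
      grown = pair-equivalent a r₁ r₂ (⊥-elim ∘ apart) cover ar₁ ar₂
      r₁≢r₂ : r₁ ≢ r₂
      r₁≢r₂ refl = apart ε
      r₁≁r₂ : ¬ Adj D r₁ r₂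
      r₁≁r₂ r₁r₂ = apart ((ar₁ , ar₂ , r₁r₂) ◅ ε)

lemma3p5 : (n : ℕ) (D : SimpleGraph n) → IsTree D → ContainsE6 D →
    ((a b : Labeling n) → ¬ Fixed D a → ¬ Fixed D b →
      OneComponent D a → OneComponent D b → Equivalent D a b)
    ×
    ((a b : Labeling n) → ¬ Fixed D a → ¬ Fixed D b →
      TwoComponents D a → TwoComponents D b → Equivalent D a b)
lemma3p5 n D (connected , acyclic)
  (v , u₁ , u₂ , _ , w₁ , _ , (vu₁ , vu₂ , _ , u₁w₁ , _) , (_ , _ , _ , v≢w₁ , _ , u₁≢u₂ , _)) =
  (λ a b _ _ one-a one-b →
    symmetric (Step D) (one-component-normal-form v a one-a) ◅◅ one-component-normal-form v b one-b) ,
  (λ a b nonfixed-a nonfixed-b two-a two-b →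
    two-normal a nonfixed-a two-a ◅◅ symmetric (Step D) (two-normal b nonfixed-b two-b))
  where
  open NormalForms D connected acyclic
  two-normal : ∀ a → ¬ Fixed D a → TwoComponents D a → Equivalent D a (Indicator.pair u₁ u₂)
  two-normal = two-components-normal-form vu₁ vu₂ u₁≢u₂ u₁w₁ (≢-sym v≢w₁)
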